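{- Let $m\geqslant 1$, let $a_1,b_1,\ldots,a_m,b_m\in\mathbb{Z}$ and let $\vartheta\in\mathbb{Z}$ with $\vartheta\geqslant 2$. Let $\ell$ and $r$ be distinct odd primes, and set $$t_\ell=\tau_\ell(\vartheta),\qquad t_r=\tau_r(\vartheta),\qquad t=\tau_{\ell r}(\vartheta),$$ and assume $$\gcd(\ell r,\,a_1\cdots a_m\vartheta)=\gcd(t_\ell,t_r)=1.$$ For $i=1,\ldots,m$ define integers $b_{i,\ell},b_{i,r}$ by $$b_{i,\ell}t_r+b_{i,r}t_\ell\equiv b_i\pmod t,\qquad 0\leqslant b_{i,\ell}<t_\ell,\quad 0\leqslant b_{i,r}<t_r.$$ Let $$S=\sum_{k_1,\ldots,k_m=1}^{t}\left(\frac{a_1\vartheta^{k_1}+\cdots+a_m\vartheta^{k_m}}{\ell r}\right)\mathbf{e}\left(\frac{b_1k_1+\cdots+b_mk_m}{t}\right),$$ $$S_\ell=\sum_{x_1,\ldots,x_m=1}^{t_\ell}\left(\frac{a_1\vartheta^{x_1}+\cdots+a_m\vartheta^{x_m}}{\ell}\right)\mathbf{e}\left(\frac{b_{1,\ell}x_1+\cdots+b_{m,\ell}x_m}{t_\ell}\right),$$ $$S_r=\sum_{y_1,\ldots,y_m=1}^{t_r}\left(\frac{a_1\vartheta^{y_1}+\cdots+a_m\vartheta^{y_m}}{r}\right)\mathbf{e}\left(\frac{b_{1,r}y_1+\cdots+b_{m,r}y_m}{t_r}\right).$$ Then $S=S_\ell S_r$.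
   Context: For an integer $\vartheta$ and a positive integer $q$ with $\gcd(\vartheta,q)=1$, $\tau_q(\vartheta)$ denotes the multiplicative order of $\vartheta$ modulo $q$. For an odd positive integer $q$, $(u/q)$ denotes the Jacobi symbol. $\mathbf{e}(x)=\exp(2\pi i x)$ for real $x$. -}

module Defs where

open import Data.Bool.Base using (Bool; true; false; if_then_else_)
open import Data.Nat.Base as ℕ using (ℕ; zero; suc; _≤ᵇ_; _≡ᵇ_)
open import Data.Nat.DivMod as ℕD using ()
open import Data.Nat.Divisibility using (_∣?_)
open import Data.Integer.Base as ℤ using (ℤ; +_; -[1+_]; _%ℕ_; 0ℤ; 1ℤ; -1ℤ)
open import Data.Integer.Divisibility as ℤD using ()
open import Data.Rational.Base as ℚ using (ℚ; 0ℚ)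
open import Data.Fin.Base using (Fin)
import Data.Fin.Base as Fin
import Data.Vec.Functional as VF
open import Data.List.Base as List using (List; []; _∷_; upTo; map; filter; foldr)
open import Data.Bool.ListAction using (any)
open import Data.Product.Base using (_×_)
open import Relation.Nullary.Negation.Core using (¬_)
open import Algebra.Bundles using (CommutativeRing)

-- Multiplicative order: IsOrder q θ k  means  k = τ_q(θ), i.e. k is the
-- least positive integer with θ^k ≡ 1 (mod q).

IsOrder : ℕ → ℤ → ℕ → Set
IsOrder q θ k =
  (1 ℕ.≤ k) ×
  ((+ q) ℤD.∣ (θ ℤ.^ k ℤ.- 1ℤ)) ×
  (∀ j → 1 ℕ.≤ j → j ℕ.< k → ¬ ((+ q) ℤD.∣ (θ ℤ.^ j ℤ.- 1ℤ)))

-- Legendre symbol (u/p) for a prime p (junk value 0 for p = 0):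
-- 0 if p ∣ u, 1 if u is a nonzero square mod p, -1 otherwise.

legendre : ℤ → ℕ → ℤ
legendre u zero = 0ℤ
legendre u (suc p') with u %ℕ suc p'
... | zero = 0ℤ
... | suc k =
  if any (λ x → ((x ℕ.* x) ℕD.% suc p') ≡ᵇ suc k) (upTo (suc p'))
  then 1ℤ else -1ℤ

firstOr : ℕ → List ℕ → ℕ
firstOr d [] = d
firstOr d (x ∷ _) = x

spf : ℕ → ℕ
spf n = firstOr n (filter (λ d → d ∣? n) (map (λ i → 2 ℕ.+ i) (upTo (n ℕ.∸ 1))))

quot : ℕ → ℕ → ℕ
quot n zero = 0
quot n (suc p) = n ℕD./ suc p

-- Jacobi symbol (u/n): product of Legendre symbols over the prime
-- factorisation of n (with multiplicity); (u/1) = 1.  The first argument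
-- is fuel (n steps suffice, since n at least halves at each step).
jac : ℕ → ℤ → ℕ → ℤ
jac zero u n = 1ℤ
jac (suc f) u n with n ≤ᵇ 1
... | true = 1ℤ
... | false = legendre u (spf n) ℤ.* jac f u (quot n (spf n))

jacobi : ℤ → ℕ → ℤ
jacobi u n = jac n u n

Σℤ : ∀ {m} → (Fin m → ℤ) → ℤ
Σℤ {zero} f = 0ℤ
Σℤ {suc m} f = f Fin.zero ℤ.+ Σℤ (λ i → f (Fin.suc i))

Πℤ : ∀ {m} → (Fin m → ℤ) → ℤ
Πℤ {zero} f = 1ℤ
Πℤ {suc m} f = f Fin.zero ℤ.* Πℤ (λ i → f (Fin.suc i))

-- the rational number n/d (d ≥ 1 in all uses; junk 0 for d = 0)
frac : ℤ → ℕ → ℚ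
frac n zero = 0ℚ
frac n (suc d) = n ℚ./ suc d

module RingSums {c ℓ} (R : CommutativeRing c ℓ) where
  open CommutativeRing R

  natR : ℕ → Carrier
  natR zero = 0#
  natR (suc n) = 1# + natR n

  intR : ℤ → Carrier
  intR (+ n) = natR n
  intR -[1+ n ] = - natR (suc n)

  Σ1to : ℕ → (ℕ → Carrier) → Carrier
  Σ1to t f = foldr (λ k s → f k + s) 0# (map suc (upTo t))

  tupleSum : (m t : ℕ) → ((Fin m → ℕ) → Carrier) → Carrier
  tupleSum zero t F = F (λ ())
  tupleSum (suc m) t F = Σ1to t (λ k → tupleSum m t (λ ks → F (k VF.∷ ks)))

{-# OPTIONS --safe #-}

-- Since t_ℓ and t_r are coprime, t = t_ℓ t_r. The summand of S is the product of a factor depending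
-- on the exponents only modulo t_ℓ and one depending on them only modulo t_r: the Jacobi symbol (·/ℓr)
-- is (·/ℓ)(·/r), and θ^{t_ℓ} ≡ 1 (mod ℓ) makes (·/ℓ) t_ℓ-periodic in each exponent (likewise for r),
-- while b ≡ b_ℓ t_r + b_r t_ℓ (mod t) gives e(bk/t) = e(b_ℓ k/t_ℓ) e(b_r k/t_r). By the Chinese
-- remainder theorem, summing such a product over k < t_ℓ t_r gives the product of the two sums.

module Submission where

open import Defs
open import Data.Nat.Base as ℕ using (ℕ; _%_)
open import Data.Nat.GCD using (gcd)
open import Data.Nat.Primality using (Prime)
open import Data.Integer.Base as ℤ using (ℤ; +_; 1ℤ)
open import Data.Integer.Divisibility as ℤD using ()
import Data.Integer.GCD as ℤG
open import Data.Rational.Base as ℚ using (ℚ)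
open import Data.Fin.Base using (Fin)
open import Relation.Binary.PropositionalEquality using (_≡_; _≢_)
open import Algebra.Bundles using (CommutativeRing)

open import Data.Nat.Base using (zero; suc; NonZero)
import Data.Nat.Properties as ℕP
import Data.Nat.DivMod as ℕD
import Data.Nat.Divisibility as ℕDiv
open import Data.Nat.Divisibility.Core using (hasNonTrivialDivisor)
open import Data.Nat.Coprimality as Coprime using (Coprime)
open import Data.Nat.LCM using (lcm; lcm-least; gcd*lcm; m∣lcm[m,n]; n∣lcm[m,n])
open import Data.Nat.Primality using (_Rough_; prime⇒nonZero; prime⇒nonTrivial; prime⇒rough)
open import Data.Integer.Base using (0ℤ)
import Data.Integer.Properties as ℤP
import Data.Integer.DivMod as ℤDM
open import Data.Integer.Divisibility.Signed as ℤS using (divides)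
open import Data.Integer.Tactic.RingSolver using (solve-∀)
open import Data.Sign.Base as Sign using (Sign)
open import Data.Rational.Base using (fromℚᵘ; toℚᵘ)
import Data.Rational.Properties as ℚP
open import Data.Rational.Unnormalised.Base as ℚᵘ using (mkℚᵘ)
import Data.Rational.Unnormalised.Properties as ℚᵘP
import Data.Fin.Base as Fin
import Data.Fin.Properties as FinP
open import Data.Fin.Permutation using (Permutation′; permutation)
open import Data.Vec.Functional using (_∷_)
open import Data.List.Base using (filter; applyUpTo; map; foldr)
import Data.List.Properties as LP
open import Data.Product.Base using (∃; _,_; proj₁; proj₂)
open import Data.Sum.Base using (inj₁; inj₂)
open import Function.Base using (_∘_; id)
open import Relation.Nullary.Decidable.Core using (Dec; yes; no)
open import Relation.Nullary.Negation using (¬_; contradiction)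
open import Relation.Binary.Definitions using (tri<; tri≈; tri>)
open import Relation.Binary.PropositionalEquality
  using (refl; sym; trans; cong; cong₂; subst; subst₂; module ≡-Reasoning)

infix 4 _≡_mod_

-- A record rather than the bare divisibility, so that x and y can be inferred from a congruence.
record _≡_mod_ (x y : ℤ) (d : ℕ) : Set where
  constructor mod-by
  field divides-difference : + d ℤS.∣ x ℤ.- y

open _≡_mod_

module _ {d : ℕ} where

  ≡mod-refl : ∀ {x} → x ≡ x mod d
  ≡mod-refl {x} = mod-by (divides 0ℤ (lemma x))
    where
    lemma : ∀ x → x ℤ.- x ≡ 0ℤ ℤ.* + d
    lemma x = trans (ℤP.+-inverseʳ x) (sym (ℤP.*-zeroˡ (+ d)))

  ≡⇒≡mod : ∀ {x y} → x ≡ y → x ≡ y mod d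
  ≡⇒≡mod refl = ≡mod-refl

  ≡mod-sym : ∀ {x y} → x ≡ y mod d → y ≡ x mod d
  ≡mod-sym {x} {y} (mod-by d∣x-y) = mod-by (subst (_ ℤS.∣_) (lemma x y) (ℤS.∣m⇒∣-m d∣x-y))
    where
    lemma : ∀ x y → ℤ.- (x ℤ.- y) ≡ y ℤ.- x
    lemma = solve-∀

  ≡mod-trans : ∀ {x y z} → x ≡ y mod d → y ≡ z mod d → x ≡ z mod d
  ≡mod-trans {x} {y} {z} (mod-by d∣x-y) (mod-by d∣y-z) =
    mod-by (subst (_ ℤS.∣_) (lemma x y z) (ℤS.∣m∣n⇒∣m+n d∣x-y d∣y-z))
    where
    lemma : ∀ x y z → (x ℤ.- y) ℤ.+ (y ℤ.- z) ≡ x ℤ.- z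
    lemma = solve-∀

  ≡mod-+ : ∀ {x y u v} → x ≡ y mod d → u ≡ v mod d → x ℤ.+ u ≡ y ℤ.+ v mod d
  ≡mod-+ {x} {y} {u} {v} (mod-by d∣x-y) (mod-by d∣u-v) =
    mod-by (subst (_ ℤS.∣_) (lemma x y u v) (ℤS.∣m∣n⇒∣m+n d∣x-y d∣u-v))
    where
    lemma : ∀ x y u v → (x ℤ.- y) ℤ.+ (u ℤ.- v) ≡ (x ℤ.+ u) ℤ.- (y ℤ.+ v)
    lemma = solve-∀

  ≡mod-* : ∀ {x y u v} → x ≡ y mod d → u ≡ v mod d → x ℤ.* u ≡ y ℤ.* v mod d
  ≡mod-* {x} {y} {u} {v} (mod-by d∣x-y) (mod-by d∣u-v) =
    mod-by (subst (_ ℤS.∣_) (lemma x y u v)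
      (ℤS.∣m∣n⇒∣m+n (ℤS.∣m⇒∣m*n u d∣x-y) (ℤS.∣n⇒∣m*n y d∣u-v)))
    where
    lemma : ∀ x y u v → (x ℤ.- y) ℤ.* u ℤ.+ y ℤ.* (u ℤ.- v) ≡ x ℤ.* u ℤ.- y ℤ.* v
    lemma = solve-∀

  ≡mod-^ : ∀ {x y} → x ≡ y mod d → ∀ n → x ℤ.^ n ≡ y ℤ.^ n mod d
  ≡mod-^ x≡y zero = ≡mod-refl
  ≡mod-^ x≡y (suc n) = ≡mod-* x≡y (≡mod-^ x≡y n)

  ≡mod-Σℤ : ∀ {m} {f g : Fin m → ℤ} → (∀ i → f i ≡ g i mod d) → Σℤ f ≡ Σℤ g mod d
  ≡mod-Σℤ {zero} f≡g = ≡mod-refl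
  ≡mod-Σℤ {suc m} f≡g = ≡mod-+ (f≡g Fin.zero) (≡mod-Σℤ (λ i → f≡g (Fin.suc i)))

  +-multiple-≡mod : ∀ x k → x ℤ.+ k ℤ.* + d ≡ x mod d
  +-multiple-≡mod x k = mod-by (divides k (lemma x k (+ d)))
    where
    lemma : ∀ x k d → (x ℤ.+ k ℤ.* d) ℤ.- x ≡ k ℤ.* d
    lemma = solve-∀

  ≡mod⇒+-multiple : ∀ {x y} → x ≡ y mod d → ∃ λ k → x ≡ y ℤ.+ k ℤ.* + d
  ≡mod⇒+-multiple {x} {y} (mod-by (divides k x-y≡kd)) =
    k , trans (lemma x y) (cong (λ z → y ℤ.+ z) x-y≡kd)
    where
    lemma : ∀ x y → x ≡ y ℤ.+ (x ℤ.- y)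
    lemma = solve-∀

  ≤-≡mod⇒≡ : ∀ {a b} → a ℕ.≤ b → b ℕ.< d → + a ≡ + b mod d → a ≡ b
  ≤-≡mod⇒≡ {a} {b} a≤b b<d (mod-by d∣a-b) =
    ℕP.≤-antisym a≤b (ℕP.m∸n≡0⇒m≤n
      (small-multiple≡0 d∣b∸a (ℕP.≤-<-trans (ℕP.m∸n≤m b a) b<d)))
    where
    d∣b∸a : d ℕDiv.∣ b ℕ.∸ a
    d∣b∸a = subst (d ℕDiv.∣_)
      (trans (cong ℤ.∣_∣ (ℤP.m-n≡m⊖n a b)) (ℤP.∣⊖∣-≤ a≤b)) (ℤS.∣⇒∣ᵤ d∣a-b)
    small-multiple≡0 : ∀ {n} → d ℕDiv.∣ n → n ℕ.< d → n ≡ 0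
    small-multiple≡0 {zero} _ _ = refl
    small-multiple≡0 {suc n} d∣n n<d = contradiction d∣n (ℕDiv.>⇒∤ n<d)

  ≡mod-<⇒≡ : ∀ {a b} → a ℕ.< d → b ℕ.< d → + a ≡ + b mod d → a ≡ b
  ≡mod-<⇒≡ {a} {b} a<d b<d a≡b with ℕP.≤-total a b
  ... | inj₁ a≤b = ≤-≡mod⇒≡ a≤b b<d a≡b
  ... | inj₂ b≤a = sym (≤-≡mod⇒≡ b≤a a<d (≡mod-sym a≡b))

  ≡mod-+-cancelʳ : ∀ {x y z} → x ℤ.+ z ≡ y ℤ.+ z mod d → x ≡ y mod d
  ≡mod-+-cancelʳ {x} {y} {z} (mod-by d∣x+z-y+z) = mod-by (subst (_ ℤS.∣_) (lemma x y z) d∣x+z-y+z)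
    where
    lemma : ∀ x y z → (x ℤ.+ z) ℤ.- (y ℤ.+ z) ≡ x ℤ.- y
    lemma = solve-∀

  ≡mod-*-cancelʳ : ∀ {n x y} → Coprime d n → x ℤ.* + n ≡ y ℤ.* + n mod d → x ≡ y mod d
  ≡mod-*-cancelʳ {n} {x} {y} d⊥n (mod-by d∣xn-yn) =
    mod-by (ℤS.∣ᵤ⇒∣ (Coprime.coprime-divisor d⊥n d∣n*∣x-y∣))
    where
    lemma : ∀ x y n → x ℤ.* n ℤ.- y ℤ.* n ≡ (x ℤ.- y) ℤ.* n
    lemma = solve-∀
    d∣n*∣x-y∣ : d ℕDiv.∣ n ℕ.* ℤ.∣ x ℤ.- y ∣
    d∣n*∣x-y∣ = subst (d ℕDiv.∣_)
      (trans (cong ℤ.∣_∣ (lemma x y (+ n))) (trans (ℤP.abs-* (x ℤ.- y) (+ n)) (ℕP.*-comm _ n)))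
      (ℤS.∣⇒∣ᵤ d∣xn-yn)

  ≡mod-∣ : ∀ {d′ x y} → d′ ℕDiv.∣ d → x ≡ y mod d → x ≡ y mod d′
  ≡mod-∣ d′∣d (mod-by d∣x-y) = mod-by (ℤS.∣-trans (ℤS.∣ᵤ⇒∣ d′∣d) d∣x-y)

  module _ .{{_ : NonZero d}} where

    ≡mod-%ℕ : ∀ x → x ≡ + (x ℤ.%ℕ d) mod d
    ≡mod-%ℕ x = subst (_≡ + (x ℤ.%ℕ d) mod d) (sym (ℤDM.a≡a%ℕn+[a/ℕn]*n x d))
                  (+-multiple-≡mod (+ (x ℤ.%ℕ d)) (x ℤ./ℕ d))

    ≡mod⇒%ℕ≡ : ∀ {x y} → x ≡ y mod d → x ℤ.%ℕ d ≡ y ℤ.%ℕ d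
    ≡mod⇒%ℕ≡ {x} {y} x≡y = ≡mod-<⇒≡ (ℤDM.n%ℕd<d x d) (ℤDM.n%ℕd<d y d)
      (≡mod-trans (≡mod-sym (≡mod-%ℕ x)) (≡mod-trans x≡y (≡mod-%ℕ y)))

    %≡⇒≡mod : ∀ {x y} → x % d ≡ y % d → + x ≡ + y mod d
    %≡⇒≡mod {x} {y} x%d≡y%d =
      ≡mod-trans (≡mod-%ℕ (+ x))
        (subst (λ r → + r ≡ + y mod d) (sym x%d≡y%d) (≡mod-sym (≡mod-%ℕ (+ y))))

Σℤ-linear : ∀ {m} (f g : Fin m → ℤ) x y →
  Σℤ (λ i → f i ℤ.* x ℤ.+ g i ℤ.* y) ≡ Σℤ f ℤ.* x ℤ.+ Σℤ g ℤ.* y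
Σℤ-linear {zero} f g x y = refl
Σℤ-linear {suc m} f g x y = trans
  (cong (λ s → f Fin.zero ℤ.* x ℤ.+ g Fin.zero ℤ.* y ℤ.+ s) (Σℤ-linear (f ∘ Fin.suc) (g ∘ Fin.suc) x y))
  (lemma (f Fin.zero) (g Fin.zero) (Σℤ (f ∘ Fin.suc)) (Σℤ (g ∘ Fin.suc)) x y)
  where
  lemma : ∀ a b c d x y →
    (a ℤ.* x ℤ.+ b ℤ.* y) ℤ.+ (c ℤ.* x ℤ.+ d ℤ.* y) ≡ (a ℤ.+ c) ℤ.* x ℤ.+ (b ℤ.+ d) ℤ.* y
  lemma = solve-∀

Σℤ-linear-≡mod : ∀ {m d} {b b₁ b₂ : Fin m → ℤ} c₁ c₂ (k : Fin m → ℤ) →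
  (∀ i → b₁ i ℤ.* c₁ ℤ.+ b₂ i ℤ.* c₂ ≡ b i mod d) →
  Σℤ (λ i → b i ℤ.* k i)
    ≡ Σℤ (λ i → b₁ i ℤ.* k i) ℤ.* c₁ ℤ.+ Σℤ (λ i → b₂ i ℤ.* k i) ℤ.* c₂ mod d
Σℤ-linear-≡mod {b₁ = b₁} {b₂} c₁ c₂ k b≡ =
  subst (_ ≡_mod _) (Σℤ-linear (λ i → b₁ i ℤ.* k i) (λ i → b₂ i ℤ.* k i) c₁ c₂)
    (≡mod-Σℤ (λ i → ≡mod-trans (≡mod-* (≡mod-sym (b≡ i)) (≡mod-refl {x = k i}))
                               (≡⇒≡mod (lemma (b₁ i) (b₂ i) c₁ c₂ (k i)))))
  where
  lemma : ∀ b₁ b₂ c₁ c₂ k →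
    (b₁ ℤ.* c₁ ℤ.+ b₂ ℤ.* c₂) ℤ.* k ≡ b₁ ℤ.* k ℤ.* c₁ ℤ.+ b₂ ℤ.* k ℤ.* c₂
  lemma = solve-∀

coprime⇒lcm≡* : ∀ {m n} → Coprime m n → lcm m n ≡ m ℕ.* n
coprime⇒lcm≡* {m} {n} m⊥n = begin
  lcm m n           ≡⟨ ℕP.*-identityˡ (lcm m n) ⟨
  1 ℕ.* lcm m n     ≡⟨ cong (ℕ._* lcm m n) (Coprime.coprime⇒gcd≡1 m⊥n) ⟨
  gcd m n ℕ.* lcm m n ≡⟨ gcd*lcm m n ⟩
  m ℕ.* n           ∎
  where open ≡-Reasoning

≡mod-lcm : ∀ {d e x y} → x ≡ y mod d → x ≡ y mod e → x ≡ y mod lcm d e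
≡mod-lcm (mod-by d∣x-y) (mod-by e∣x-y) =
  mod-by (ℤS.∣ᵤ⇒∣ (lcm-least (ℤS.∣⇒∣ᵤ d∣x-y) (ℤS.∣⇒∣ᵤ e∣x-y)))

primes-coprime : ∀ {p q} → Prime p → Prime q → p ≢ q → Coprime p q
primes-coprime {p} {q} p-prime q-prime p≢q with ℕP.<-cmp p q
... | tri< p<q _ _ = Coprime.sym (Coprime.prime⇒coprime q-prime {{prime⇒nonZero p-prime}} p<q)
... | tri≈ _ p≡q _ = contradiction p≡q p≢q
... | tri> _ _ q<p = Coprime.prime⇒coprime p-prime {{prime⇒nonZero q-prime}} q<p

module _ {q : ℕ} {θ : ℤ} where

  order-pow≡1 : ∀ {k} → IsOrder q θ k → θ ℤ.^ k ≡ 1ℤ mod q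
  order-pow≡1 (_ , q∣θ^k-1 , _) = mod-by (ℤS.∣ᵤ⇒∣ q∣θ^k-1)

  pow-multiple≡1 : ∀ {k} → θ ℤ.^ k ≡ 1ℤ mod q → ∀ s → θ ℤ.^ (s ℕ.* k) ≡ 1ℤ mod q
  pow-multiple≡1 {k} θ^k≡1 s = subst₂ (_≡_mod q) θ^k^s≡θ^sk (ℤP.^-zeroˡ s) (≡mod-^ θ^k≡1 s)
    where
    θ^k^s≡θ^sk : (θ ℤ.^ k) ℤ.^ s ≡ θ ℤ.^ (s ℕ.* k)
    θ^k^s≡θ^sk = trans (ℤP.^-*-assoc θ k s) (cong (θ ℤ.^_) (ℕP.*-comm k s))

  pow-∣≡1 : ∀ {k n} → θ ℤ.^ k ≡ 1ℤ mod q → k ℕDiv.∣ n → θ ℤ.^ n ≡ 1ℤ mod q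
  pow-∣≡1 θ^k≡1 (ℕDiv.divides s refl) = pow-multiple≡1 θ^k≡1 s

  pow-%≡ : ∀ {k} .{{_ : NonZero k}} → θ ℤ.^ k ≡ 1ℤ mod q → ∀ x → θ ℤ.^ x ≡ θ ℤ.^ (x % k) mod q
  pow-%≡ {k} θ^k≡1 x = subst₂ (_≡_mod q) θ^r*θ^sk≡θ^x (ℤP.*-identityʳ _)
    (≡mod-* (≡mod-refl {x = θ ℤ.^ (x % k)}) (pow-multiple≡1 {k} θ^k≡1 (x ℕ./ k)))
    where
    θ^r*θ^sk≡θ^x : θ ℤ.^ (x % k) ℤ.* θ ℤ.^ (x ℕ./ k ℕ.* k) ≡ θ ℤ.^ x
    θ^r*θ^sk≡θ^x = trans (sym (ℤP.^-distribˡ-+-* θ (x % k) _))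
                         (cong (θ ℤ.^_) (sym (ℕD.m≡m%n+[m/n]*n x k)))

  pow-%-cong : ∀ {k} .{{_ : NonZero k}} → θ ℤ.^ k ≡ 1ℤ mod q →
    ∀ {x y} → x % k ≡ y % k → θ ℤ.^ x ≡ θ ℤ.^ y mod q
  pow-%-cong θ^k≡1 {x} {y} x%k≡y%k = ≡mod-trans (pow-%≡ θ^k≡1 x)
    (subst (λ r → θ ℤ.^ r ≡ θ ℤ.^ y mod q) (sym x%k≡y%k) (≡mod-sym (pow-%≡ θ^k≡1 y)))

  order≢0 : ∀ {k} → IsOrder q θ k → NonZero k
  order≢0 (1≤k , _) = ℕ.>-nonZero 1≤k

  order-∣ : ∀ {k n} → IsOrder q θ k → θ ℤ.^ n ≡ 1ℤ mod q → k ℕDiv.∣ n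
  order-∣ {suc k} {n} order@(_ , _ , minimal) θ^n≡1 with n % suc k in n%k≡r
  ... | zero = ℕDiv.m%n≡0⇒n∣m n (suc k) n%k≡r
  ... | suc r = contradiction (ℤS.∣⇒∣ᵤ (divides-difference θ^r≡1))
                  (minimal (suc r) (ℕ.s≤s ℕ.z≤n) (subst (ℕ._< suc k) n%k≡r (ℕD.m%n<n n (suc k))))
    where
    θ^r≡1 : θ ℤ.^ suc r ≡ 1ℤ mod q
    θ^r≡1 = ≡mod-trans
      (subst (λ r → θ ℤ.^ r ≡ θ ℤ.^ n mod q) n%k≡r (≡mod-sym (pow-%≡ (order-pow≡1 order) n))) θ^n≡1

order-mod-product : ∀ {l r θ tl tr t} → Coprime l r →
  IsOrder l θ tl → IsOrder r θ tr → IsOrder (l ℕ.* r) θ t → t ≡ lcm tl tr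
order-mod-product {l} {r} {θ} {tl} {tr} l⊥r l-order r-order lr-order = ℕDiv.∣-antisym
  (order-∣ lr-order (subst (θ ℤ.^ lcm tl tr ≡ 1ℤ mod_) (coprime⇒lcm≡* l⊥r)
    (≡mod-lcm (pow-∣≡1 (order-pow≡1 l-order) (m∣lcm[m,n] tl tr))
              (pow-∣≡1 (order-pow≡1 r-order) (n∣lcm[m,n] tl tr)))))
  (lcm-least (order-∣ l-order (≡mod-∣ (ℕDiv.m∣m*n r) θ^t≡1))
             (order-∣ r-order (≡mod-∣ (ℕDiv.n∣m*n l) θ^t≡1)))
  where
  θ^t≡1 = order-pow≡1 lr-order

firstOr-filter-applyUpTo : ∀ {P : ℕ → Set} (P? : ∀ x → Dec (P x)) x (f : ℕ → ℕ) {i k} →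
  i ℕ.< k → P (f i) → (∀ j → j ℕ.< i → ¬ P (f j)) → firstOr x (filter P? (applyUpTo f k)) ≡ f i
firstOr-filter-applyUpTo P? x f {zero} {suc k} _ Pfi _ = cong (firstOr x) (LP.filter-accept P? Pfi)
firstOr-filter-applyUpTo P? x f {suc i} {suc k} (ℕ.s≤s i<k) Pfi none-before =
  trans (cong (firstOr x) (LP.filter-reject P? (none-before 0 ℕ.z<s)))
        (firstOr-filter-applyUpTo P? x (f ∘ suc) i<k Pfi (λ j j<i → none-before (suc j) (ℕ.s≤s j<i)))

spf-rough : ∀ {d n} → 2 ℕ.≤ d → d ℕ.≤ n → d ℕDiv.∣ n → d Rough n → spf n ≡ d
spf-rough {suc (suc i)} {n} (ℕ.s≤s (ℕ.s≤s ℕ.z≤n)) d≤n d∣n d-rough =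
  trans (cong (λ ds → firstOr n (filter (λ d → d ℕDiv.∣? n) ds)) (LP.map-upTo (2 ℕ.+_) (n ℕ.∸ 1)))
        (firstOr-filter-applyUpTo (λ d → d ℕDiv.∣? n) n (2 ℕ.+_) (ℕP.∸-monoˡ-≤ 1 d≤n) d∣n
          (λ j j<i j+2∣n → d-rough (hasNonTrivialDivisor (ℕ.s≤s (ℕ.s≤s j<i)) j+2∣n)))

prime≥2 : ∀ {p} → Prime p → 2 ℕ.≤ p
prime≥2 {p} p-prime = ℕ.nonTrivial⇒n>1 p {{prime⇒nonTrivial p-prime}}

spf-prime : ∀ {p} → Prime p → spf p ≡ p
spf-prime p-prime = spf-rough (prime≥2 p-prime) ℕP.≤-refl ℕDiv.∣-refl (prime⇒rough p-prime)

rough-semiprime : ∀ {p q} → Prime p → Prime q → p ℕ.≤ q → p Rough (p ℕ.* q)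
rough-semiprime {p} {q} p-prime q-prime p≤q (hasNonTrivialDivisor {d} d<p d∣pq) =
  prime⇒rough q-prime (hasNonTrivialDivisor (ℕP.<-≤-trans d<p p≤q) d∣q)
  where
  d∣q : d ℕDiv.∣ q
  d∣q = Coprime.coprime-divisor
    (Coprime.sym (Coprime.prime⇒coprime p-prime {{ℕ.nonTrivial⇒nonZero d}} d<p)) d∣pq

jac-unfold : ∀ f u n → 2 ℕ.≤ n → jac (suc f) u n ≡ legendre u (spf n) ℤ.* jac f u (quot n (spf n))
jac-unfold f u (suc (suc n)) (ℕ.s≤s (ℕ.s≤s ℕ.z≤n)) = refl

jac-1 : ∀ f u → jac f u 1 ≡ 1ℤ
jac-1 zero u = refl
jac-1 (suc f) u = refl

semiprime≥2 : ∀ {p q} → Prime p → Prime q → 2 ℕ.≤ p ℕ.* q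
semiprime≥2 {p} {q} p-prime q-prime =
  ℕP.≤-trans (prime≥2 p-prime) (ℕP.m≤m*n p q {{prime⇒nonZero q-prime}})

jac-prime : ∀ {f} u {p} → 1 ℕ.≤ f → Prime p → jac f u p ≡ legendre u p
jac-prime {suc f} u {p@(suc _)} _ p-prime = begin
  jac (suc f) u p
    ≡⟨ jac-unfold f u p (prime≥2 p-prime) ⟩
  legendre u (spf p) ℤ.* jac f u (quot p (spf p))
    ≡⟨ cong (λ s → legendre u s ℤ.* jac f u (quot p s)) (spf-prime p-prime) ⟩
  legendre u p ℤ.* jac f u (p ℕ./ p)
    ≡⟨ cong (λ n → legendre u p ℤ.* jac f u n) (ℕD.n/n≡1 p) ⟩
  legendre u p ℤ.* jac f u 1
    ≡⟨ cong (legendre u p ℤ.*_) (jac-1 f u) ⟩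
  legendre u p ℤ.* 1ℤ
    ≡⟨ ℤP.*-identityʳ (legendre u p) ⟩
  legendre u p
    ∎
  where open ≡-Reasoning

jac-semiprime : ∀ {f} u {p q} → 2 ℕ.≤ f → Prime p → Prime q → p ℕ.≤ q →
  jac f u (p ℕ.* q) ≡ legendre u p ℤ.* legendre u q
jac-semiprime {suc f} u {p@(suc _)} {q} (ℕ.s≤s 1≤f) p-prime q-prime p≤q = begin
  jac (suc f) u pq
    ≡⟨ jac-unfold f u pq (semiprime≥2 p-prime q-prime) ⟩
  legendre u (spf pq) ℤ.* jac f u (quot pq (spf pq))
    ≡⟨ cong (λ s → legendre u s ℤ.* jac f u (quot pq s)) spf-pq ⟩
  legendre u p ℤ.* jac f u (p ℕ.* q ℕ./ p)
    ≡⟨ cong (λ n → legendre u p ℤ.* jac f u n) pq/p≡q ⟩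
  legendre u p ℤ.* jac f u q
    ≡⟨ cong (legendre u p ℤ.*_) (jac-prime u 1≤f q-prime) ⟩
  legendre u p ℤ.* legendre u q
    ∎
  where
  open ≡-Reasoning
  pq = p ℕ.* q
  spf-pq : spf pq ≡ p
  spf-pq = spf-rough (prime≥2 p-prime) (ℕP.m≤m*n p q {{prime⇒nonZero q-prime}}) (ℕDiv.m∣m*n q)
             (rough-semiprime p-prime q-prime p≤q)
  pq/p≡q : pq ℕ./ p ≡ q
  pq/p≡q = trans (cong (ℕ._/ p) (ℕP.*-comm p q)) (ℕD.m*n/n≡m q p)

jacobi-prime : ∀ u {p} → Prime p → jacobi u p ≡ legendre u p
jacobi-prime u p-prime = jac-prime u (ℕP.<⇒≤ (prime≥2 p-prime)) p-prime

jacobi-semiprime : ∀ u {p q} → Prime p → Prime q → jacobi u (p ℕ.* q) ≡ legendre u p ℤ.* legendre u q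
jacobi-semiprime u {p} {q} p-prime q-prime with ℕP.≤-total p q
... | inj₁ p≤q = jac-semiprime u (semiprime≥2 p-prime q-prime) p-prime q-prime p≤q
... | inj₂ q≤p = begin
  jacobi u (p ℕ.* q)              ≡⟨ cong (jacobi u) (ℕP.*-comm p q) ⟩
  jacobi u (q ℕ.* p)              ≡⟨ jac-semiprime u (semiprime≥2 q-prime p-prime) q-prime p-prime q≤p ⟩
  legendre u q ℤ.* legendre u p   ≡⟨ ℤP.*-comm (legendre u q) (legendre u p) ⟩
  legendre u p ℤ.* legendre u q   ∎
  where open ≡-Reasoning

legendre-%ℕ : ∀ u v p → u ℤ.%ℕ suc p ≡ v ℤ.%ℕ suc p → legendre u (suc p) ≡ legendre v (suc p)
legendre-%ℕ u v p eq with u ℤ.%ℕ suc p | v ℤ.%ℕ suc p | eq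
... | r | .r | refl = refl

jacobi-prime-≡mod : ∀ {p u v} → Prime p → u ≡ v mod p → jacobi u p ≡ jacobi v p
jacobi-prime-≡mod {p@(suc p-1)} {u} {v} p-prime u≡v = begin
  jacobi u p     ≡⟨ jacobi-prime u p-prime ⟩
  legendre u p   ≡⟨ legendre-%ℕ u v p-1 (≡mod⇒%ℕ≡ u≡v) ⟩
  legendre v p   ≡⟨ jacobi-prime v p-prime ⟨
  jacobi v p     ∎
  where open ≡-Reasoning

fromℚᵘ-homo-+ : ∀ u v → fromℚᵘ (u ℚᵘ.+ v) ≡ fromℚᵘ u ℚ.+ fromℚᵘ v
fromℚᵘ-homo-+ u v = ℚP.toℚᵘ-injective (begin
  toℚᵘ (fromℚᵘ (u ℚᵘ.+ v))
    ≈⟨ ℚP.toℚᵘ-fromℚᵘ (u ℚᵘ.+ v) ⟩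
  u ℚᵘ.+ v
    ≈⟨ ℚᵘP.+-cong (ℚᵘP.≃-sym (ℚP.toℚᵘ-fromℚᵘ u)) (ℚᵘP.≃-sym (ℚP.toℚᵘ-fromℚᵘ v)) ⟩
  toℚᵘ (fromℚᵘ u) ℚᵘ.+ toℚᵘ (fromℚᵘ v)
    ≈⟨ ℚP.toℚᵘ-homo-+ (fromℚᵘ u) (fromℚᵘ v) ⟨
  toℚᵘ (fromℚᵘ u ℚ.+ fromℚᵘ v)
    ∎)
  where open ℚᵘP.≃-Reasoning

frac-+ : ∀ x y d₁ d₂ .{{_ : NonZero d₁}} .{{_ : NonZero d₂}} →
  frac (x ℤ.* + d₂ ℤ.+ y ℤ.* + d₁) (d₁ ℕ.* d₂) ≡ frac x d₁ ℚ.+ frac y d₂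
frac-+ x y (suc d₁) (suc d₂) = fromℚᵘ-homo-+ (mkℚᵘ x d₁) (mkℚᵘ y d₂)

frac-+-integer : ∀ x k d .{{_ : NonZero d}} → frac (x ℤ.+ k ℤ.* + d) d ≡ frac x d ℚ.+ (k ℚ./ 1)
frac-+-integer x k d@(suc _) =
  trans (cong₂ frac (lemma x k (+ d)) (sym (ℕP.*-identityʳ d))) (frac-+ x k d 1)
  where
  lemma : ∀ x k d → x ℤ.+ k ℤ.* d ≡ x ℤ.* 1ℤ ℤ.+ k ℤ.* d
  lemma = solve-∀

injective⇒surjective : ∀ {n} (f : Fin n → Fin n) → (∀ {x y} → f x ≡ f y → x ≡ y) →
  ∀ y → ∃ λ x → f x ≡ y
injective⇒surjective {n} f f-injective y with FinP.any? (λ x → f x FinP.≟ y)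
... | yes hit = hit
injective⇒surjective {suc n} f f-injective y | no miss =
  contradiction (FinP.injective⇒≤ g-injective) (ℕP.<-irrefl refl)
  where
  g : Fin (suc n) → Fin n
  g x = Fin.punchOut {i = y} {j = f x} (λ y≡fx → miss (x , sym y≡fx))
  g-injective : ∀ {x x′} → g x ≡ g x′ → x ≡ x′
  g-injective {x} {x′} = f-injective ∘
    FinP.punchOut-injective (λ y≡fx → miss (x , sym y≡fx)) (λ y≡fx′ → miss (x′ , sym y≡fx′))

injective⇒permutation : ∀ {n} (f : Fin n → Fin n) → (∀ {x y} → f x ≡ f y → x ≡ y) → Permutation′ n
injective⇒permutation f f-injective =
  permutation f (proj₁ ∘ surjective) (proj₂ ∘ surjective) (f-injective ∘ proj₂ ∘ surjective ∘ f)
  where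
  surjective = injective⇒surjective f f-injective

suc-%-cong : ∀ {j k} n .{{_ : NonZero n}} → j % n ≡ k % n → suc j % n ≡ suc k % n
suc-%-cong {j} {k} n j%n≡k%n =
  trans (ℕD.%-distribˡ-+ 1 j n)
        (trans (cong (λ r → (1 % n ℕ.+ r) % n) j%n≡k%n) (sym (ℕD.%-distribˡ-+ 1 k n)))

affine-%-injective : ∀ {p n} i .{{_ : NonZero p}} → Coprime p n → ∀ {j k} → j ℕ.< p → k ℕ.< p →
  (j ℕ.* n ℕ.+ i) % p ≡ (k ℕ.* n ℕ.+ i) % p → j ≡ k
affine-%-injective {p} {n} i p⊥n {j} {k} j<p k<p eq =
  ≡mod-<⇒≡ j<p k<p
    (≡mod-*-cancelʳ p⊥n (≡mod-+-cancelʳ (subst₂ (_≡_mod p) (pos-*+ j) (pos-*+ k) (%≡⇒≡mod eq))))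
  where
  pos-*+ : ∀ j → + (j ℕ.* n ℕ.+ i) ≡ + j ℤ.* + n ℤ.+ + i
  pos-*+ j = trans (ℤP.pos-+ (j ℕ.* n) i) (cong (ℤ._+ + i) (ℤP.pos-* j n))

module RangeSums {c ℓ} (R : CommutativeRing c ℓ) where

  open CommutativeRing R hiding (trans) renaming (refl to ≈-refl; sym to ≈-sym)
  open RingSums R
  open import Algebra.Properties.Semiring.Sum semiring
    using (sum; sum-cong-≋; sum-cong-≗; ∑-comm; ∑-permute; *-distribˡ-sum; *-distribʳ-sum)
  open import Relation.Binary.Reasoning.Setoid setoid

  ∑< : ℕ → (ℕ → Carrier) → Carrier
  ∑< n f = sum {n} (f ∘ Fin.toℕ)

  ∑<-cong : ∀ n {f g} → (∀ k → f k ≈ g k) → ∑< n f ≈ ∑< n g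
  ∑<-cong n f≈g = sum-cong-≋ {n} (f≈g ∘ Fin.toℕ)

  Σ1to≡∑< : ∀ t f → Σ1to t f ≡ ∑< t (f ∘ suc)
  Σ1to≡∑< t f = foldr-applyUpTo t id
    where
    foldr-applyUpTo : ∀ n h → foldr (λ k s → f k + s) 0# (map suc (applyUpTo h n)) ≡ ∑< n (f ∘ suc ∘ h)
    foldr-applyUpTo zero h = refl
    foldr-applyUpTo (suc n) h = cong (λ s → f (suc (h 0)) + s) (foldr-applyUpTo n (h ∘ suc))

  ∑<-+ : ∀ m n f → ∑< (m ℕ.+ n) f ≈ ∑< m f + ∑< n (λ k → f (m ℕ.+ k))
  ∑<-+ zero n f = ≈-sym (+-identityˡ _)
  ∑<-+ (suc m) n f = begin
    f 0 + ∑< (m ℕ.+ n) (f ∘ suc)                                 ≈⟨ +-congˡ (∑<-+ m n (f ∘ suc)) ⟩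
    f 0 + (∑< m (f ∘ suc) + ∑< n (λ k → f (suc m ℕ.+ k)))        ≈⟨ +-assoc _ _ _ ⟨
    (f 0 + ∑< m (f ∘ suc)) + ∑< n (λ k → f (suc m ℕ.+ k))        ∎

  ∑<-* : ∀ m n f → ∑< (m ℕ.* n) f ≈ ∑< m (λ j → ∑< n (λ i → f (j ℕ.* n ℕ.+ i)))
  ∑<-* zero n f = ≈-refl
  ∑<-* (suc m) n f = begin
    ∑< (n ℕ.+ m ℕ.* n) f
      ≈⟨ ∑<-+ n (m ℕ.* n) f ⟩
    ∑< n f + ∑< (m ℕ.* n) (λ k → f (n ℕ.+ k))
      ≈⟨ +-congˡ (∑<-* m n (λ k → f (n ℕ.+ k))) ⟩
    ∑< n f + ∑< m (λ j → ∑< n (λ i → f (n ℕ.+ (j ℕ.* n ℕ.+ i))))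
      ≈⟨ +-congˡ (∑<-cong m (λ j → ∑<-cong n (λ i →
           reflexive (cong f (sym (ℕP.+-assoc n (j ℕ.* n) i)))))) ⟩
    ∑< n f + ∑< m (λ j → ∑< n (λ i → f (n ℕ.+ j ℕ.* n ℕ.+ i)))
      ∎

  ∑<-reindex : ∀ n (φ : ℕ → ℕ) → (∀ k → k ℕ.< n → φ k ℕ.< n) →
    (∀ {j k} → j ℕ.< n → k ℕ.< n → φ j ≡ φ k → j ≡ k) → ∀ f → ∑< n (f ∘ φ) ≈ ∑< n f
  ∑<-reindex n φ φ<n φ-injective f = begin
    ∑< n (f ∘ φ)
      ≡⟨ sum-cong-≗ {n} (λ i → cong f (sym (FinP.toℕ-fromℕ< (φ<n _ (FinP.toℕ<n i))))) ⟩
    sum (λ i → f (Fin.toℕ (ψ i)))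
      ≈⟨ ∑-permute (f ∘ Fin.toℕ) (injective⇒permutation ψ ψ-injective) ⟨
    ∑< n f
      ∎
    where
    ψ : Fin n → Fin n
    ψ i = Fin.fromℕ< (φ<n (Fin.toℕ i) (FinP.toℕ<n i))
    ψ-injective : ∀ {i j} → ψ i ≡ ψ j → i ≡ j
    ψ-injective {i} {j} ψi≡ψj = FinP.toℕ-injective (φ-injective (FinP.toℕ<n i) (FinP.toℕ<n j)
      (trans (sym (FinP.toℕ-fromℕ< _)) (trans (cong Fin.toℕ ψi≡ψj) (FinP.toℕ-fromℕ< _))))

  Periodic : (n : ℕ) .{{_ : NonZero n}} → (ℕ → Carrier) → Set ℓ
  Periodic n f = ∀ j k → j % n ≡ k % n → f j ≈ f k

  ∑<-affine : ∀ p n i .{{_ : NonZero p}} → Coprime p n → ∀ {h} → Periodic p h →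
    ∑< p (λ j → h (j ℕ.* n ℕ.+ i)) ≈ ∑< p h
  ∑<-affine p n i p⊥n {h} h-periodic = begin
    ∑< p (λ j → h (j ℕ.* n ℕ.+ i))
      ≈⟨ ∑<-cong p (λ j → h-periodic _ _ (sym (ℕD.m%n%n≡m%n (j ℕ.* n ℕ.+ i) p))) ⟩
    ∑< p (λ j → h ((j ℕ.* n ℕ.+ i) % p))
      ≈⟨ ∑<-reindex p (λ j → (j ℕ.* n ℕ.+ i) % p) (λ j _ → ℕD.m%n<n _ p) (affine-%-injective i p⊥n) h ⟩
    ∑< p h
      ∎

  ∑<-periodic-* : ∀ n p .{{_ : NonZero n}} .{{_ : NonZero p}} → Coprime n p → ∀ {g h} →
    Periodic n g → Periodic p h → ∑< (n ℕ.* p) (λ k → g k * h k) ≈ ∑< n g * ∑< p h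
  ∑<-periodic-* n p n⊥p {g} {h} g-periodic h-periodic = begin
    ∑< (n ℕ.* p) (λ k → g k * h k)
      ≡⟨ cong (λ m → ∑< m (λ k → g k * h k)) (ℕP.*-comm n p) ⟩
    ∑< (p ℕ.* n) (λ k → g k * h k)
      ≈⟨ ∑<-* p n (λ k → g k * h k) ⟩
    ∑< p (λ j → ∑< n (λ i → g (j ℕ.* n ℕ.+ i) * h (j ℕ.* n ℕ.+ i)))
      ≈⟨ ∑<-cong p (λ j → ∑<-cong n (λ i →
           *-congʳ {h (j ℕ.* n ℕ.+ i)} (g-periodic _ i (jn+i%n≡i%n j i)))) ⟩
    ∑< p (λ j → ∑< n (λ i → g i * h (j ℕ.* n ℕ.+ i)))
      ≈⟨ ∑-comm {p} {n} (λ j i → g (Fin.toℕ i) * h (Fin.toℕ j ℕ.* n ℕ.+ Fin.toℕ i)) ⟩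
    ∑< n (λ i → ∑< p (λ j → g i * h (j ℕ.* n ℕ.+ i)))
      ≈⟨ ∑<-cong n (λ i → *-distribˡ-sum {p} (g i) (λ j → h (Fin.toℕ j ℕ.* n ℕ.+ i))) ⟨
    ∑< n (λ i → g i * ∑< p (λ j → h (j ℕ.* n ℕ.+ i)))
      ≈⟨ ∑<-cong n (λ i → *-congˡ {g i} (∑<-affine p n i (Coprime.sym n⊥p) h-periodic)) ⟩
    ∑< n (λ i → g i * ∑< p h)
      ≈⟨ *-distribʳ-sum {n} (∑< p h) (g ∘ Fin.toℕ) ⟨
    ∑< n g * ∑< p h
      ∎
    where
    jn+i%n≡i%n : ∀ j i → (j ℕ.* n ℕ.+ i) % n ≡ i % n
    jn+i%n≡i%n j i = trans (cong (_% n) (ℕP.+-comm (j ℕ.* n) i)) (ℕD.[m+kn]%n≡m%n i j n)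

  CoordinatewisePeriodic : (n : ℕ) .{{_ : NonZero n}} → ∀ m → ((Fin m → ℕ) → Carrier) → Set ℓ
  CoordinatewisePeriodic n m f = ∀ x y → (∀ i → x i % n ≡ y i % n) → f x ≈ f y

  tupleSum-cong : ∀ m t {f g : (Fin m → ℕ) → Carrier} → (∀ x → f x ≈ g x) →
    tupleSum m t f ≈ tupleSum m t g
  tupleSum-cong zero t f≈g = f≈g _
  tupleSum-cong (suc m) t {f} {g} f≈g = begin
    Σ1to t (λ k → tupleSum m t (λ x → f (k ∷ x)))
      ≡⟨ Σ1to≡∑< t _ ⟩
    ∑< t (λ k → tupleSum m t (λ x → f (suc k ∷ x)))
      ≈⟨ ∑<-cong t (λ k → tupleSum-cong m t (λ x → f≈g (suc k ∷ x))) ⟩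
    ∑< t (λ k → tupleSum m t (λ x → g (suc k ∷ x)))
      ≡⟨ Σ1to≡∑< t _ ⟨
    Σ1to t (λ k → tupleSum m t (λ x → g (k ∷ x)))
      ∎

  tupleSum-periodic-* : ∀ m n p .{{_ : NonZero n}} .{{_ : NonZero p}} → Coprime n p → ∀ {g h} →
    CoordinatewisePeriodic n m g → CoordinatewisePeriodic p m h →
    tupleSum m (n ℕ.* p) (λ x → g x * h x) ≈ tupleSum m n g * tupleSum m p h
  tupleSum-periodic-* zero n p n⊥p g-periodic h-periodic = ≈-refl
  tupleSum-periodic-* (suc m) n p n⊥p {g} {h} g-periodic h-periodic = begin
    Σ1to (n ℕ.* p) (λ k → tupleSum m (n ℕ.* p) (λ x → g (k ∷ x) * h (k ∷ x)))
      ≡⟨ Σ1to≡∑< (n ℕ.* p) _ ⟩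
    ∑< (n ℕ.* p) (λ k → tupleSum m (n ℕ.* p) (λ x → g (suc k ∷ x) * h (suc k ∷ x)))
      ≈⟨ ∑<-cong (n ℕ.* p) (λ k →
           tupleSum-periodic-* m n p n⊥p (fix-head {k = suc k} g-periodic) (fix-head {k = suc k} h-periodic)) ⟩
    ∑< (n ℕ.* p) (λ k → g′ k * h′ k)
      ≈⟨ ∑<-periodic-* n p n⊥p (vary-head g-periodic) (vary-head h-periodic) ⟩
    ∑< n g′ * ∑< p h′
      ≡⟨ cong₂ _*_ (Σ1to≡∑< n _) (Σ1to≡∑< p _) ⟨
    Σ1to n (λ k → tupleSum m n (λ x → g (k ∷ x))) * Σ1to p (λ k → tupleSum m p (λ x → h (k ∷ x)))
      ∎
    where
    g′ h′ : ℕ → Carrier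
    g′ k = tupleSum m n (λ x → g (suc k ∷ x))
    h′ k = tupleSum m p (λ x → h (suc k ∷ x))
    fix-head : ∀ {q} .{{_ : NonZero q}} {f} {k} →
      CoordinatewisePeriodic q (suc m) f → CoordinatewisePeriodic q m (λ x → f (k ∷ x))
    fix-head f-periodic x y x≡y = f-periodic _ _ λ { Fin.zero → refl ; (Fin.suc i) → x≡y i }
    vary-head : ∀ {q} .{{_ : NonZero q}} {f} → CoordinatewisePeriodic q (suc m) f →
      Periodic q (λ k → tupleSum m q (λ x → f (suc k ∷ x)))
    vary-head {q} f-periodic j k j≡k =
      tupleSum-cong m q (λ x → f-periodic _ _ λ { Fin.zero → suc-%-cong q j≡k ; (Fin.suc i) → refl })

module IntegerCast {c ℓ} (R : CommutativeRing c ℓ) where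

  open CommutativeRing R hiding (refl) renaming (sym to ≈-sym; trans to ≈-trans)
  open RingSums R
  open import Algebra.Properties.Ring ring using (-1*x≈-x; -‿involutive)
  open import Algebra.Properties.Semiring.Mult semiring using (_×_; ×1-homo-*)
  open import Algebra.Properties.CommutativeSemigroup *-commutativeSemigroup using (interchange)
  open import Relation.Binary.Reasoning.Setoid setoid

  σ : Sign → Carrier
  σ Sign.+ = 1#
  σ Sign.- = - 1#

  σ-* : ∀ s t → σ (s Sign.* t) ≈ σ s * σ t
  σ-* Sign.+ t = ≈-sym (*-identityˡ (σ t))
  σ-* Sign.- Sign.+ = ≈-sym (*-identityʳ (- 1#))
  σ-* Sign.- Sign.- = ≈-sym (≈-trans (-1*x≈-x (- 1#)) (-‿involutive 1#))

  natR≡×1# : ∀ n → natR n ≡ n × 1#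
  natR≡×1# zero = refl
  natR≡×1# (suc n) = cong (λ x → 1# + x) (natR≡×1# n)

  natR-* : ∀ m n → natR (m ℕ.* n) ≈ natR m * natR n
  natR-* m n = begin
    natR (m ℕ.* n)        ≡⟨ natR≡×1# (m ℕ.* n) ⟩
    (m ℕ.* n) × 1#        ≈⟨ ×1-homo-* m n ⟩
    (m × 1#) * (n × 1#)   ≡⟨ cong₂ _*_ (natR≡×1# m) (natR≡×1# n) ⟨
    natR m * natR n       ∎

  intR-◃ : ∀ s n → intR (s ℤ.◃ n) ≈ σ s * natR n
  intR-◃ s zero = ≈-sym (zeroʳ (σ s))
  intR-◃ Sign.+ (suc n) = ≈-sym (*-identityˡ _)
  intR-◃ Sign.- (suc n) = ≈-sym (-1*x≈-x _)

  intR-* : ∀ i j → intR (i ℤ.* j) ≈ intR i * intR j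
  intR-* i j = begin
    intR (i ℤ.* j)
      ≈⟨ intR-◃ (s Sign.* t) (ℤ.∣ i ∣ ℕ.* ℤ.∣ j ∣) ⟩
    σ (s Sign.* t) * natR (ℤ.∣ i ∣ ℕ.* ℤ.∣ j ∣)
      ≈⟨ *-cong (σ-* s t) (natR-* ℤ.∣ i ∣ ℤ.∣ j ∣) ⟩
    (σ s * σ t) * (natR ℤ.∣ i ∣ * natR ℤ.∣ j ∣)
      ≈⟨ interchange _ _ _ _ ⟩
    (σ s * natR ℤ.∣ i ∣) * (σ t * natR ℤ.∣ j ∣)
      ≈⟨ *-cong (intR-◃ s ℤ.∣ i ∣) (intR-◃ t ℤ.∣ j ∣) ⟨
    intR (s ℤ.◃ ℤ.∣ i ∣) * intR (t ℤ.◃ ℤ.∣ j ∣)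
      ≡⟨ cong₂ (λ u v → intR u * intR v) (ℤP.◃-inverse i) (ℤP.◃-inverse j) ⟩
    intR i * intR j
      ∎
    where
    s = ℤ.sign i
    t = ℤ.sign j

module CharacterSums {c ℓ} (R : CommutativeRing c ℓ) where

  open CommutativeRing R hiding (refl; sym) renaming (trans to ≈-trans)
  open RingSums R
  open RangeSums R
  open IntegerCast R
  open import Algebra.Properties.CommutativeSemigroup *-commutativeSemigroup using (interchange)
  open import Relation.Binary.Reasoning.Setoid setoid

  module _ (e : ℚ → Carrier) (e-+ : ∀ x y → e (x ℚ.+ y) ≈ e x * e y) (e-ℤ : ∀ n → e (n ℚ./ 1) ≈ 1#) where

    e-frac-≡mod : ∀ d .{{_ : NonZero d}} {x y} → x ≡ y mod d → e (frac x d) ≈ e (frac y d)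
    e-frac-≡mod d {x} {y} x≡y with ≡mod⇒+-multiple x≡y
    ... | k , x≡y+kd = begin
      e (frac x d)                      ≡⟨ cong (λ z → e (frac z d)) x≡y+kd ⟩
      e (frac (y ℤ.+ k ℤ.* + d) d)      ≡⟨ cong e (frac-+-integer y k d) ⟩
      e (frac y d ℚ.+ (k ℚ./ 1))        ≈⟨ e-+ (frac y d) (k ℚ./ 1) ⟩
      e (frac y d) * e (k ℚ./ 1)        ≈⟨ *-congˡ (e-ℤ k) ⟩
      e (frac y d) * 1#                 ≈⟨ *-identityʳ _ ⟩
      e (frac y d)                      ∎

    e-frac-split : ∀ d₁ d₂ .{{_ : NonZero d₁}} .{{_ : NonZero d₂}} {x x₁ x₂} →
      x ≡ x₁ ℤ.* + d₂ ℤ.+ x₂ ℤ.* + d₁ mod (d₁ ℕ.* d₂) →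
      e (frac x (d₁ ℕ.* d₂)) ≈ e (frac x₁ d₁) * e (frac x₂ d₂)
    e-frac-split d₁ d₂ {x} {x₁} {x₂} x≡ = begin
      e (frac x (d₁ ℕ.* d₂))
        ≈⟨ e-frac-≡mod (d₁ ℕ.* d₂) {{ℕP.m*n≢0 d₁ d₂}} x≡ ⟩
      e (frac (x₁ ℤ.* + d₂ ℤ.+ x₂ ℤ.* + d₁) (d₁ ℕ.* d₂))
        ≡⟨ cong e (frac-+ x₁ x₂ d₁ d₂) ⟩
      e (frac x₁ d₁ ℚ.+ frac x₂ d₂)
        ≈⟨ e-+ (frac x₁ d₁) (frac x₂ d₂) ⟩
      e (frac x₁ d₁) * e (frac x₂ d₂)
        ∎

    module _ {m} (a : Fin m → ℤ) (θ : ℤ) where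

      summand : ℕ → (Fin m → ℤ) → ℕ → (Fin m → ℕ) → Carrier
      summand q b t k =
        intR (jacobi (Σℤ (λ i → a i ℤ.* θ ℤ.^ k i)) q) * e (frac (Σℤ (λ i → b i ℤ.* + k i)) t)

      -- S, S_ℓ and S_r are twistedSum (ℓ r) b t, twistedSum ℓ b_ℓ t_ℓ and twistedSum r b_r t_r.
      twistedSum : ℕ → (Fin m → ℤ) → ℕ → Carrier
      twistedSum q b t = tupleSum m t (summand q b t)

      summand-periodic : ∀ {p tp} .{{_ : NonZero tp}} → Prime p → IsOrder p θ tp → ∀ b →
        CoordinatewisePeriodic tp m (summand p b tp)
      summand-periodic {p} {tp} p-prime p-order b x y x≡y =
        *-cong (reflexive (cong intR (jacobi-prime-≡mod p-prime ax≡ay))) (e-frac-≡mod tp bx≡by)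
        where
        ax≡ay = ≡mod-Σℤ (λ i → ≡mod-* (≡mod-refl {x = a i}) (pow-%-cong (order-pow≡1 p-order) (x≡y i)))
        bx≡by = ≡mod-Σℤ (λ i → ≡mod-* (≡mod-refl {x = b i}) (%≡⇒≡mod (x≡y i)))

      summand-factor : ∀ {l r tl tr} .{{_ : NonZero tl}} .{{_ : NonZero tr}} → Prime l → Prime r →
        ∀ {b bl br} → (∀ i → bl i ℤ.* + tr ℤ.+ br i ℤ.* + tl ≡ b i mod (tl ℕ.* tr)) →
        ∀ k → summand (l ℕ.* r) b (tl ℕ.* tr) k ≈ summand l bl tl k * summand r br tr k
      summand-factor {l} {r} {tl} {tr} l-prime r-prime {b} {bl} {br} b≡ k = begin
        intR (jacobi A (l ℕ.* r)) * e (frac (B b) (tl ℕ.* tr))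
          ≈⟨ *-cong jacobi-factor e-factor ⟩
        (intR (jacobi A l) * intR (jacobi A r)) * (e (frac (B bl) tl) * e (frac (B br) tr))
          ≈⟨ interchange _ _ _ _ ⟩
        (intR (jacobi A l) * e (frac (B bl) tl)) * (intR (jacobi A r) * e (frac (B br) tr))
          ∎
        where
        A = Σℤ (λ i → a i ℤ.* θ ℤ.^ k i)
        B : (Fin m → ℤ) → ℤ
        B c = Σℤ (λ i → c i ℤ.* + k i)
        e-factor : e (frac (B b) (tl ℕ.* tr)) ≈ e (frac (B bl) tl) * e (frac (B br) tr)
        e-factor = e-frac-split tl tr (Σℤ-linear-≡mod {b₁ = bl} {br} (+ tr) (+ tl) (+_ ∘ k) b≡)
        jacobi-factor : intR (jacobi A (l ℕ.* r)) ≈ intR (jacobi A l) * intR (jacobi A r)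
        jacobi-factor = begin
          intR (jacobi A (l ℕ.* r))
            ≡⟨ cong intR (jacobi-semiprime A l-prime r-prime) ⟩
          intR (legendre A l ℤ.* legendre A r)
            ≈⟨ intR-* (legendre A l) (legendre A r) ⟩
          intR (legendre A l) * intR (legendre A r)
            ≡⟨ cong₂ (λ u v → intR u * intR v) (jacobi-prime A l-prime) (jacobi-prime A r-prime) ⟨
          intR (jacobi A l) * intR (jacobi A r)
            ∎

      twistedSum-multiplicative : ∀ {l r tl tr} → Prime l → Prime r →
        IsOrder l θ tl → IsOrder r θ tr → Coprime tl tr →
        ∀ {b bl br} → (∀ i → bl i ℤ.* + tr ℤ.+ br i ℤ.* + tl ≡ b i mod (tl ℕ.* tr)) →
        twistedSum (l ℕ.* r) b (tl ℕ.* tr) ≈ twistedSum l bl tl * twistedSum r br tr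
      twistedSum-multiplicative {tl = tl} {tr} l-prime r-prime l-order r-order tl⊥tr {b} {bl} {br} b≡ = ≈-trans
        (tupleSum-cong m (tl ℕ.* tr) (summand-factor l-prime r-prime {b} {bl} {br} b≡))
        (tupleSum-periodic-* m tl tr tl⊥tr (summand-periodic l-prime l-order bl) (summand-periodic r-prime r-order br))
        where
        instance
          tl≢0 : NonZero tl
          tl≢0 = order≢0 l-order
          tr≢0 : NonZero tr
          tr≢0 = order≢0 r-order

lemma4p3 : ∀ {c ℓ′} (R : CommutativeRing c ℓ′) →
  let open CommutativeRing R
      open RingSums R
  in
  (e : ℚ → Carrier) →
  (∀ x y → e (x ℚ.+ y) ≈ e x * e y) →
  (∀ (n : ℤ) → e (n ℚ./ 1) ≈ 1#) →
  (m : ℕ) → 1 ℕ.≤ m →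
  (a b : Fin m → ℤ) →
  (θ : ℤ) → + 2 ℤ.≤ θ →
  (l r : ℕ) → Prime l → Prime r → l % 2 ≡ 1 → r % 2 ≡ 1 → l ≢ r →
  (tl tr t : ℕ) →
  IsOrder l θ tl → IsOrder r θ tr → IsOrder (l ℕ.* r) θ t →
  ℤG.gcd (+ (l ℕ.* r)) (Πℤ a ℤ.* θ) ≡ 1ℤ →
  gcd tl tr ≡ 1 →
  (bl br : Fin m → ℕ) →
  (∀ i → bl i ℕ.< tl) → (∀ i → br i ℕ.< tr) →
  (∀ i → (+ t) ℤD.∣ ((+ (bl i ℕ.* tr) ℤ.+ + (br i ℕ.* tl)) ℤ.- b i)) →
  tupleSum m t (λ k →
      intR (jacobi (Σℤ (λ i → a i ℤ.* θ ℤ.^ k i)) (l ℕ.* r))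
      * e (frac (Σℤ (λ i → b i ℤ.* + k i)) t))
  ≈
  (tupleSum m tl (λ x →
      intR (jacobi (Σℤ (λ i → a i ℤ.* θ ℤ.^ x i)) l)
      * e (frac (Σℤ (λ i → + bl i ℤ.* + x i)) tl))
   *
   tupleSum m tr (λ y →
      intR (jacobi (Σℤ (λ i → a i ℤ.* θ ℤ.^ y i)) r)
      * e (frac (Σℤ (λ i → + br i ℤ.* + y i)) tr)))

lemma4p3 R e e-+ e-ℤ m _ a b θ _ l r l-prime r-prime _ _ l≢r tl tr t
         l-order r-order lr-order _ gcd[tl,tr]≡1 bl br _ _ t∣b′-b
  with trans (order-mod-product (primes-coprime l-prime r-prime l≢r) l-order r-order lr-order)
             (coprime⇒lcm≡* {tl} {tr} (Coprime.gcd≡1⇒coprime gcd[tl,tr]≡1))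
... | refl = twistedSum-multiplicative e e-+ e-ℤ a θ l-prime r-prime l-order r-order
               (Coprime.gcd≡1⇒coprime gcd[tl,tr]≡1) {b} {+_ ∘ bl} {+_ ∘ br} b≡
  where
  open CharacterSums R
  b≡ : ∀ i → + bl i ℤ.* + tr ℤ.+ + br i ℤ.* + tl ≡ b i mod (tl ℕ.* tr)
  b≡ i = subst₂ (λ u v → u ℤ.+ v ≡ b i mod (tl ℕ.* tr)) (ℤP.pos-* (bl i) tr) (ℤP.pos-* (br i) tl)
           (mod-by (ℤS.∣ᵤ⇒∣ (t∣b′-b i)))
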